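{- For $n\ge 4$, the locally twisted hypercube satisfies $\det(LTQ_n)=1$, $\dist(LTQ_n)=2$, and $\rho(LTQ_n)=1$. Furthermore, $\det(LTQ_3)=\dist(LTQ_3)=2$ and $\rho(LTQ_3)=3$.
   Context: The locally twisted hypercube is defined recursively: $LTQ_2=Q_2$ (the 4-cycle on $\mathbb{Z}_2^2$ with adjacency iff differing in one position). For $n>2$, take two disjoint copies of $LTQ_{n-1}$, prefix every vertex of the first copy with $0$ and every vertex of the second with $1$, and for every vertex $0x_2x_3\dots x_n$ of the first copy add an edge to $1(x_2+x_n)x_3\dots x_n$, addition mod 2. For a graph $G$: a determining set is a vertex set such that the only automorphism fixing each of its vertices is the identity, and $\det(G)$ is its minimum size; a coloring is distinguishing if the only automorphism preserving each color class is the identity, and $\dist(G)$ is the minimum number of colors of such a coloring; if $\dist(G)=2$, $\rho(G)$ is the minimum size of a color class over all distinguishing 2-colorings. -}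

module Defs where

open import Data.Bool using (Bool; true; false; _xor_)
open import Data.Bool.Properties using () renaming (_≟_ to _≟B_)
open import Data.Nat using (ℕ; zero; suc; _≤_)
open import Data.Fin using (Fin)
open import Data.Vec using (Vec; []; _∷_; last)
open import Data.Vec.Properties using (≡-dec)
open import Data.List using (List; length; filter; map; _++_)
open import Data.List.Membership.Propositional using (_∈_)
open import Data.Product using (Σ; ∃; _×_; _,_)
open import Data.Empty using (⊥)
open import Relation.Binary.PropositionalEquality using (_≡_; _≢_)
open import Relation.Nullary using (Dec)
open import Function.Bundles using (_↔_; Inverse; _⇔_)

record Automorphism (V : Set) (Adj : V → V → Set) : Set₁ where
  field
    perm     : V ↔ V
    preserve : ∀ u v → Adj u v ⇔ Adj (Inverse.to perm u) (Inverse.to perm v)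

module _ {V : Set} {Adj : V → V → Set} where
  open Automorphism

  app : Automorphism V Adj → V → V
  app φ = Inverse.to (perm φ)

  IsIdentity : Automorphism V Adj → Set
  IsIdentity φ = ∀ x → app φ x ≡ x

IsDetermining : (V : Set) (Adj : V → V → Set) → List V → Set₁
IsDetermining V Adj S =
  (φ : Automorphism V Adj) → (∀ v → v ∈ S → app φ v ≡ v) → IsIdentity φ

DetEq : (V : Set) (Adj : V → V → Set) → ℕ → Set₁
DetEq V Adj d =
  (Σ (List V) λ S → IsDetermining V Adj S × length S ≡ d)
  × (∀ S → IsDetermining V Adj S → d ≤ length S)

IsDistinguishing : (V : Set) (Adj : V → V → Set) {C : Set} → (V → C) → Set₁
IsDistinguishing V Adj c =
  (φ : Automorphism V Adj) → (∀ v → c (app φ v) ≡ c v) → IsIdentity φ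

DistEq : (V : Set) (Adj : V → V → Set) → ℕ → Set₁
DistEq V Adj k =
  (Σ (V → Fin k) λ c → IsDistinguishing V Adj c)
  × (∀ k' (c : V → Fin k') → IsDistinguishing V Adj c → k ≤ k')

allVecs : (n : ℕ) → List (Vec Bool n)
allVecs zero = [] ∷ᴸ []
  where open Data.List renaming (_∷_ to _∷ᴸ_)
allVecs (suc n) = map (false ∷_) (allVecs n) ++ map (true ∷_) (allVecs n)

classSize : (n : ℕ) → (Vec Bool n → Bool) → Bool → ℕ
classSize n c b = length (filter (λ v → c v ≟B b) (allVecs n))

data OneDiff : {n : ℕ} → Vec Bool n → Vec Bool n → Set where
  here  : ∀ {n x y} {xs : Vec Bool n} → x ≢ y → OneDiff (x ∷ xs) (y ∷ xs)
  there : ∀ {n x} {xs ys : Vec Bool n} → OneDiff xs ys → OneDiff (x ∷ xs) (x ∷ ys)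

twist : {n : ℕ} → Vec Bool (suc n) → Vec Bool (suc n)
twist (x ∷ xs) = (x xor last (x ∷ xs)) ∷ xs

-- adjacency of LTQ_n (meaningful for n ≥ 2; for n < 2 no edges)
LTQ : {n : ℕ} → Vec Bool n → Vec Bool n → Set
LTQ [] [] = ⊥
LTQ (x ∷ []) (y ∷ []) = ⊥
LTQ (x ∷ x' ∷ []) (y ∷ y' ∷ []) = OneDiff (x ∷ x' ∷ []) (y ∷ y' ∷ [])
LTQ (false ∷ xs@(_ ∷ _ ∷ _)) (false ∷ ys) = LTQ xs ys
LTQ (true  ∷ xs@(_ ∷ _ ∷ _)) (true  ∷ ys) = LTQ xs ys
LTQ (false ∷ xs@(_ ∷ _ ∷ _)) (true  ∷ ys) = ys ≡ twist xs
LTQ (true  ∷ xs@(_ ∷ _ ∷ _)) (false ∷ ys) = xs ≡ twist ys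

-- ρ(LTQ_n) = r (given dist = 2): minimum size of a color class over all
-- distinguishing 2-colorings
RhoEq : (n : ℕ) → ℕ → Set₁
RhoEq n r =
  (Σ (Vec Bool n → Bool) λ c → Σ Bool λ b →
      IsDistinguishing (Vec Bool n) LTQ c × classSize n c b ≡ r)
  × (∀ (c : Vec Bool n → Bool) (b : Bool) →
      IsDistinguishing (Vec Bool n) LTQ c → r ≤ classSize n c b)

{-# OPTIONS --safe #-}
module Submission where

-- For n ≥ 4 an automorphism of LTQ_n fixing 0 is the identity.  Write e_i for the neighbours
-- of 0 (the unit vectors) and L = n - 1.  A vertex whose last coordinate is 0 has the
-- hypercube neighbours x ⊕ e_i; one whose last coordinate is 1 has twisted neighbours, where
-- e_i is replaced by e_i ⊕ e_{i+1} for i ≤ n - 3.  Hence e_L is the only neighbour of 0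
-- which has 0 as its only common neighbour with two further neighbours of 0; e_{L-1} is the
-- other neighbour of 0 having a common neighbour besides 0 with e_L; and every e_k is
-- recovered from e_{k+1} and e_{k+2} through the square 0, e_k, e_k ⊕ e_{k+1}, e_{k+1} and the
-- twisted neighbourhood of e_L.  Squares in the untwisted half then carry fixed neighbourhoods
-- to all vertices.  So {0} is determining and marking 0 is a distinguishing 2-colouring with a
-- singleton class, while flipping the first coordinate is a nontrivial automorphism for n ≥ 3,
-- which gives the lower bounds.  For LTQ_3 the same propagation and eight explicit involutive
-- automorphisms are verified by exhaustive computation.

open import Defs
open import Data.Bool using (Bool; true; false; not; _xor_; _∧_)
open import Data.Bool.Properties
  using (xor-assoc; xor-comm; xor-identityˡ; xor-identityʳ; xor-same; true-xor; ¬-not; not-involutive;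
         xor-∧-commutativeRing)
  renaming (_≟_ to _≟B_)
open import Algebra.Bundles using (CommutativeRing; CommutativeMonoid)
open import Algebra.Properties.CommutativeSemigroup
  (CommutativeMonoid.commutativeSemigroup (CommutativeRing.+-commutativeMonoid xor-∧-commutativeRing))
  using () renaming (interchange to xor-interchange)
open import Data.Empty using (⊥-elim)
open import Data.Fin using (Fin)
open import Data.Fin.Properties using (¬Fin0; 2↔Bool)
open import Data.List using (List; []; _∷_; length; filter; map; _++_)
open import Data.List.Properties using (filter-≐; filter-++; filter-none; length-++)
open import Data.List.Membership.Propositional using (_∈_)
open import Data.List.Membership.Propositional.Properties
  using (∈-filter⁺; ∈-map⁺; ∈-++⁺ˡ; ∈-++⁺ʳ)
open import Data.List.Relation.Unary.All as All using (All; []; _∷_)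
open import Data.List.Relation.Unary.Any as Any using (Any; here; there)
open import Data.Nat using (ℕ; zero; suc; _+_; _∸_; _≤_; _<_; z≤n; s≤s; _≟_; _<?_; _≤?_)
open import Data.Nat.Properties
  using ( ≤-refl; <-trans; <-≤-trans; m≤n⇒m≤1+n; <⇒≢; suc-injective; ≤∧≢⇒<; ≮⇒≥; +-suc; m∸n+n≡m; m≤n+m
        ; anyUpTo?)
open import Data.Product using (Σ; _×_; _,_; proj₁; proj₂)
open import Data.Sum as Sum using (_⊎_; inj₁; inj₂)
open import Data.Vec using (Vec; []; _∷_; last; zipWith; replicate)
open import Data.Vec.Properties using (≡-dec)
open import Data.List.Membership.DecPropositional (≡-dec {n = 3} _≟B_) using (_∈?_)
open import Data.Vec.Relation.Binary.Pointwise.Inductive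
  using (Pointwise-≡⇒≡; zipWith-assoc; zipWith-comm; zipWith-identityˡ; zipWith-identityʳ)
open import Function.Bundles using (Inverse; Equivalence; mk⇔; mk↔ₛ′)
open import Relation.Binary.PropositionalEquality
open import Relation.Nullary using (¬_; Dec; yes; no; contradiction)
open import Relation.Binary.Definitions using (DecidableEquality)
open import Relation.Nullary.Decidable
  using (True; toWitness; map′; from-yes; ¬?; _×-dec_; _⊎-dec_; _→-dec_)
open import Relation.Unary using (Decidable)

-- Automorphisms of an arbitrary graph

module _ {V : Set} {Adj : V → V → Set} (φ : Automorphism V Adj) where
  open Automorphism φ using (perm; preserve)
  open Inverse perm using (from; strictlyInverseˡ; strictlyInverseʳ)

  app-injective : ∀ {x y} → app φ x ≡ app φ y → x ≡ y
  app-injective {x} {y} eq = begin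
    x               ≡⟨ strictlyInverseʳ x ⟨
    from (app φ x)  ≡⟨ cong from eq ⟩
    from (app φ y)  ≡⟨ strictlyInverseʳ y ⟩
    y               ∎
    where open ≡-Reasoning

  app-from : ∀ y → app φ (from y) ≡ y
  app-from = strictlyInverseˡ

  app-adj : ∀ {u v} → Adj u v → Adj (app φ u) (app φ v)
  app-adj {u} {v} = Equivalence.to (preserve u v)

  app-adj⁻¹ : ∀ {u v} → Adj (app φ u) (app φ v) → Adj u v
  app-adj⁻¹ {u} {v} = Equivalence.from (preserve u v)

  app-adj-fixed : ∀ {a z} → app φ a ≡ a → Adj z a → Adj (app φ z) a
  app-adj-fixed {z = z} φa p = subst (Adj (app φ z)) φa (app-adj p)

  app-≢-fixed : ∀ {a z} → app φ a ≡ a → z ≢ a → app φ z ≢ a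
  app-≢-fixed φa z≢a eq = z≢a (app-injective (trans eq (sym φa)))

  fixed-if-unique : (P : V → Set) → (∀ {z} → P z → P (app φ z)) →
                    ∀ {t} → P t → (∀ {z} → P z → z ≡ t ⊎ app φ z ≡ z) → app φ t ≡ t
  fixed-if-unique P pres Pt unique with unique (pres Pt)
  ... | inj₁ φt≡t = φt≡t
  ... | inj₂ φφt≡φt = app-injective φφt≡φt

involution-automorphism : {V : Set} {Adj : V → V → Set} (σ : V → V) →
                          (∀ x → σ (σ x) ≡ x) → (∀ u v → Adj u v → Adj (σ u) (σ v)) →
                          Automorphism V Adj
involution-automorphism {Adj = Adj} σ σσ adj = record
  { perm     = mk↔ₛ′ σ σ σσ σσ
  ; preserve = λ u v → mk⇔ (adj u v) (λ p → subst₂ Adj (σσ u) (σσ v) (adj (σ u) (σ v) p))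
  }

module _ {V : Set} {Adj : V → V → Set} (φ : Automorphism V Adj) (φ≢id : ¬ IsIdentity φ) where

  determining-nonempty : ∀ S → IsDetermining V Adj S → 1 ≤ length S
  determining-nonempty []      det = ⊥-elim (φ≢id (det φ λ { _ () }))
  determining-nonempty (_ ∷ _) _   = s≤s z≤n

  constant-not-distinguishing : {C : Set} (c : V → C) → (∀ u v → c u ≡ c v) →
                                ¬ IsDistinguishing V Adj c
  constant-not-distinguishing c const dist = φ≢id (dist φ λ v → const (app φ v) v)

  distinguishing-≥2 : ∀ k (c : V → Fin k) → IsDistinguishing V Adj c → 2 ≤ k
  distinguishing-≥2 0 c dist = ⊥-elim (φ≢id (dist φ λ v → ⊥-elim (¬Fin0 (c v))))
  distinguishing-≥2 1 c dist = ⊥-elim (constant-not-distinguishing c (λ u v → fin1 (c u) (c v)) dist)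
    where
    fin1 : ∀ (i j : Fin 1) → i ≡ j
    fin1 Fin.zero Fin.zero = refl
  distinguishing-≥2 (suc (suc k)) _ _ = s≤s (s≤s z≤n)

distEq-2 : ∀ {V : Set} {Adj : V → V → Set} (φ : Automorphism V Adj) → ¬ IsIdentity φ →
           (c : V → Bool) → IsDistinguishing V Adj c → DistEq V Adj 2
distEq-2 φ φ≢id c dist = ((λ v → from (c v)) , λ ψ pres → dist ψ λ v → from-injective (pres v)) ,
                         distinguishing-≥2 φ φ≢id
  where
  open Inverse 2↔Bool using (to; from; strictlyInverseˡ)
  from-injective : ∀ {x y} → from x ≡ from y → x ≡ y
  from-injective {x} {y} eq = trans (sym (strictlyInverseˡ x)) (trans (cong to eq) (strictlyInverseˡ y))

-- Boolean vectors

xor-cancelʳ : ∀ a b → (a xor b) xor b ≡ a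
xor-cancelʳ a b = trans (xor-assoc a b b) (trans (cong (a xor_) (xor-same b)) (xor-identityʳ a))

allVecs-complete : ∀ {n} (v : Vec Bool n) → v ∈ allVecs n
allVecs-complete []                    = here refl
allVecs-complete {suc n} (false ∷ v) = ∈-++⁺ˡ (∈-map⁺ (false ∷_) (allVecs-complete v))
allVecs-complete {suc n} (true ∷ v)  =
  ∈-++⁺ʳ (map (false ∷_) (allVecs n)) (∈-map⁺ (true ∷_) (allVecs-complete v))

classSize-pos : ∀ {n} (c : Vec Bool n → Bool) {b v} → c v ≡ b → 1 ≤ classSize n c b
classSize-pos {n} c {b} {v} cv≡b = nonempty (∈-filter⁺ (λ w → c w ≟B b) (allVecs-complete v) cv≡b)
  where
  nonempty : ∀ {xs : List (Vec Bool n)} → v ∈ xs → 1 ≤ length xs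
  nonempty (here _)  = s≤s z≤n
  nonempty (there _) = s≤s z≤n

classSize-cong : ∀ {n} {c c′ : Vec Bool n → Bool} → (∀ v → c v ≡ c′ v) →
                 ∀ b → classSize n c b ≡ classSize n c′ b
classSize-cong {n} {c} {c′} c≗c′ b = cong length (filter-≐ (λ v → c v ≟B b) (λ v → c′ v ≟B b)
  ((λ {v} p → trans (sym (c≗c′ v)) p) , (λ {v} p → trans (c≗c′ v) p)) (allVecs n))

colour-classes-nonempty : ∀ {n} {Adj : Vec Bool n → Vec Bool n → Set}
                          (φ : Automorphism (Vec Bool n) Adj) →
                          ¬ IsIdentity φ → ∀ (c : Vec Bool n → Bool) b →
                          IsDistinguishing (Vec Bool n) Adj c → 1 ≤ classSize n c b
colour-classes-nonempty {n} φ φ≢id c b dist with classSize n c b in size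
... | suc _ = s≤s z≤n
... | zero  = ⊥-elim (constant-not-distinguishing φ φ≢id c constant dist)
  where
  avoids-b : ∀ v → c v ≢ b
  avoids-b v cv≡b with subst (1 ≤_) size (classSize-pos c cv≡b)
  ... | ()
  constant : ∀ u v → c u ≡ c v
  constant u v = trans (¬-not (avoids-b u)) (sym (¬-not (avoids-b v)))

infixl 6 _⊕_
_⊕_ : ∀ {n} → Vec Bool n → Vec Bool n → Vec Bool n
_⊕_ = zipWith _xor_

0v : ∀ {n} → Vec Bool n
0v = replicate _ false

⊕-assoc : ∀ {n} (x y z : Vec Bool n) → x ⊕ y ⊕ z ≡ x ⊕ (y ⊕ z)
⊕-assoc x y z = Pointwise-≡⇒≡ (zipWith-assoc xor-assoc x y z)

⊕-comm : ∀ {n} (x y : Vec Bool n) → x ⊕ y ≡ y ⊕ x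
⊕-comm x y = Pointwise-≡⇒≡ (zipWith-comm xor-comm x y)

⊕-identityˡ : ∀ {n} (x : Vec Bool n) → 0v ⊕ x ≡ x
⊕-identityˡ x = Pointwise-≡⇒≡ (zipWith-identityˡ xor-identityˡ x)

⊕-identityʳ : ∀ {n} (x : Vec Bool n) → x ⊕ 0v ≡ x
⊕-identityʳ x = Pointwise-≡⇒≡ (zipWith-identityʳ xor-identityʳ x)

⊕-self : ∀ {n} (x : Vec Bool n) → x ⊕ x ≡ 0v
⊕-self []       = refl
⊕-self (x ∷ xs) = cong₂ _∷_ (xor-same x) (⊕-self xs)

x⊕y⊕y≡x : ∀ {n} (x y : Vec Bool n) → x ⊕ y ⊕ y ≡ x
x⊕y⊕y≡x x y = trans (⊕-assoc x y y) (trans (cong (x ⊕_) (⊕-self y)) (⊕-identityʳ x))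

x⊕[x⊕y]≡y : ∀ {n} (x y : Vec Bool n) → x ⊕ (x ⊕ y) ≡ y
x⊕[x⊕y]≡y x y = trans (sym (⊕-assoc x x y)) (trans (cong (_⊕ y) (⊕-self x)) (⊕-identityˡ y))

⊕-cancelˡ-≡ : ∀ {n} (x : Vec Bool n) {u v} → x ⊕ u ≡ x ⊕ v → u ≡ v
⊕-cancelˡ-≡ x {u} {v} eq = trans (sym (x⊕[x⊕y]≡y x u)) (trans (cong (x ⊕_) eq) (x⊕[x⊕y]≡y x v))

x⊕y≡0⇒x≡y : ∀ {n} {x y : Vec Bool n} → x ⊕ y ≡ 0v → x ≡ y
x⊕y≡0⇒x≡y {x = x} eq = sym (⊕-cancelˡ-≡ x (trans eq (sym (⊕-self x))))

⊕-swapʳ : ∀ {n} (x u v : Vec Bool n) → x ⊕ u ⊕ v ≡ x ⊕ v ⊕ u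
⊕-swapʳ x u v = trans (⊕-assoc x u v) (trans (cong (x ⊕_) (⊕-comm u v)) (sym (⊕-assoc x v u)))

∀-Vec? : ∀ {n} {P : Vec Bool n → Set} → Decidable P → Dec (∀ v → P v)
∀-Vec? {n} P? = map′ (λ all v → All.lookup all (allVecs-complete v))
                     (λ all → All.tabulate λ {v} _ → all v)
                     (All.all? P? (allVecs n))

infix 4 _≟ᵥ_
_≟ᵥ_ : ∀ {n} → DecidableEquality (Vec Bool n)
_≟ᵥ_ = ≡-dec _≟B_
bit : ∀ {n} → Vec Bool n → ℕ → Bool
bit []       _       = false
bit (x ∷ _)  zero    = x
bit (_ ∷ xs) (suc p) = bit xs p

bit-⊕ : ∀ {n} (x y : Vec Bool n) p → bit (x ⊕ y) p ≡ bit x p xor bit y p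
bit-⊕ []       []       p       = refl
bit-⊕ (x ∷ xs) (y ∷ ys) zero    = refl
bit-⊕ (x ∷ xs) (y ∷ ys) (suc p) = bit-⊕ xs ys p

bit-0v : ∀ {n} p → bit (0v {n}) p ≡ false
bit-0v {zero}  p       = refl
bit-0v {suc n} zero    = refl
bit-0v {suc n} (suc p) = bit-0v {n} p

bit-≥ : ∀ {n} (x : Vec Bool n) {p} → n ≤ p → bit x p ≡ false
bit-≥ []       _         = refl
bit-≥ (x ∷ xs) (s≤s n≤p) = bit-≥ xs n≤p

bit-ext : ∀ {n} {x y : Vec Bool n} → (∀ p → bit x p ≡ bit y p) → x ≡ y
bit-ext {x = []}     {[]}     _  = refl
bit-ext {x = x ∷ xs} {y ∷ ys} eq = cong₂ _∷_ (eq zero) (bit-ext (λ p → eq (suc p)))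

last≡bit : ∀ {k} (x : Vec Bool (suc k)) → last x ≡ bit x k
last≡bit (x ∷ [])     = refl
last≡bit (x ∷ y ∷ xs) = last≡bit (y ∷ xs)

last-⊕ : ∀ {k} (x y : Vec Bool (suc k)) → last (x ⊕ y) ≡ last x xor last y
last-⊕ {k} x y = begin
  last (x ⊕ y)               ≡⟨ last≡bit (x ⊕ y) ⟩
  bit (x ⊕ y) k              ≡⟨ bit-⊕ x y k ⟩
  bit x k xor bit y k        ≡⟨ cong₂ _xor_ (last≡bit x) (last≡bit y) ⟨
  last x xor last y          ∎
  where open ≡-Reasoning

unit : ∀ {n} → ℕ → Vec Bool n
unit {zero}  _       = []
unit {suc n} zero    = true ∷ 0v
unit {suc n} (suc i) = false ∷ unit i

bit-unit-same : ∀ {n i} → i < n → bit (unit {n} i) i ≡ true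
bit-unit-same {suc n} {zero}  _         = refl
bit-unit-same {suc n} {suc i} (s≤s i<n) = bit-unit-same i<n

bit-unit-other : ∀ {n i p} → i ≢ p → bit (unit {n} i) p ≡ false
bit-unit-other {zero}                  _   = refl
bit-unit-other {suc n} {zero}  {zero}  i≢p = contradiction refl i≢p
bit-unit-other {suc n} {zero}  {suc p} _   = bit-0v {n} p
bit-unit-other {suc n} {suc i} {zero}  _   = refl
bit-unit-other {suc n} {suc i} {suc p} i≢p = bit-unit-other {n} (λ i≡p → i≢p (cong suc i≡p))

bit-unit-true⇒≡ : ∀ {n i p} → bit (unit {n} i) p ≡ true → i ≡ p
bit-unit-true⇒≡ {n} {i} {p} bit≡true with i ≟ p
... | yes i≡p = i≡p
... | no  i≢p with trans (sym bit≡true) (bit-unit-other {n} i≢p)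
...   | ()

unit-injective : ∀ {n i j} → i < n → unit {n} i ≡ unit j → i ≡ j
unit-injective {n} {i} i<n eq =
  sym (bit-unit-true⇒≡ {n} (trans (cong (λ x → bit x i) (sym eq)) (bit-unit-same i<n)))

unit⊕unit≡0⇒≡ : ∀ {n i j} → i < n → unit {n} i ⊕ unit j ≡ 0v → i ≡ j
unit⊕unit≡0⇒≡ i<n eq = unit-injective i<n (x⊕y≡0⇒x≡y eq)

bit-unit⊕unit-other : ∀ {n c d p} → c ≢ p → d ≢ p → bit (unit {n} c ⊕ unit d) p ≡ false
bit-unit⊕unit-other {n} {c} {d} {p} c≢p d≢p =
  trans (bit-⊕ (unit {n} c) (unit d) p) (cong₂ _xor_ (bit-unit-other {n} c≢p) (bit-unit-other {n} d≢p))

bit-unit⊕unit-true : ∀ {n} c d {p} → bit (unit {n} c ⊕ unit d) p ≡ true → c ≡ p ⊎ d ≡ p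
bit-unit⊕unit-true {n} c d {p} bit≡true with c ≟ p | d ≟ p
... | yes c≡p | _       = inj₁ c≡p
... | no _    | yes d≡p = inj₂ d≡p
... | no c≢p  | no d≢p  with trans (sym bit≡true) (bit-unit⊕unit-other {n} c≢p d≢p)
...   | ()
unit⊕unit-injective : ∀ {n a b c d} → a < n → b < n → c < n →
                      unit {n} a ⊕ unit b ≡ unit c ⊕ unit d →
                      (a ≡ c × b ≡ d) ⊎ (a ≡ d × b ≡ c) ⊎ (a ≡ b × c ≡ d)
unit⊕unit-injective {n} {a} {b} {c} {d} a<n b<n c<n eq with a ≟ b
... | yes refl = inj₂ (inj₂ (refl , unit⊕unit≡0⇒≡ c<n (trans (sym eq) (⊕-self (unit a)))))
... | no a≢b with bit-unit⊕unit-true {n} c d {a} bit-a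
  where
  bit-a : bit (unit {n} c ⊕ unit d) a ≡ true
  bit-a = begin
    bit (unit {n} c ⊕ unit d) a                ≡⟨ cong (λ x → bit x a) eq ⟨
    bit (unit {n} a ⊕ unit b) a                ≡⟨ bit-⊕ (unit {n} a) (unit b) a ⟩
    bit (unit {n} a) a xor bit (unit {n} b) a  ≡⟨ cong₂ _xor_ (bit-unit-same a<n)
                                                            (bit-unit-other {n} (λ b≡a → a≢b (sym b≡a))) ⟩
    true                                       ∎
    where open ≡-Reasoning
...   | inj₁ refl = inj₁ (refl , unit-injective b<n (⊕-cancelˡ-≡ (unit a) eq))
...   | inj₂ refl =
  inj₂ (inj₁ (refl , unit-injective b<n (⊕-cancelˡ-≡ (unit a) (trans eq (⊕-comm (unit c) (unit a))))))

parity : ∀ {n} → Vec Bool n → Bool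
parity []       = false
parity (x ∷ xs) = x xor parity xs

parity-⊕ : ∀ {n} (x y : Vec Bool n) → parity (x ⊕ y) ≡ parity x xor parity y
parity-⊕ []       []       = refl
parity-⊕ (x ∷ xs) (y ∷ ys) = trans (cong ((x xor y) xor_) (parity-⊕ xs ys))
                                   (xor-interchange x y (parity xs) (parity ys))

parity-0v : ∀ {n} → parity (0v {n}) ≡ false
parity-0v {zero}  = refl
parity-0v {suc n} = parity-0v {n}

parity-unit : ∀ {n i} → i < n → parity (unit {n} i) ≡ true
parity-unit {suc n} {zero}  _         = cong (true xor_) (parity-0v {n})
parity-unit {suc n} {suc i} (s≤s i<n) = parity-unit i<n

parity-unit⊕unit : ∀ {n i j} → i < n → j < n → parity (unit {n} i ⊕ unit j) ≡ false
parity-unit⊕unit {n} {i} {j} i<n j<n =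
  trans (parity-⊕ (unit {n} i) (unit j)) (cong₂ _xor_ (parity-unit i<n) (parity-unit j<n))

isZero : ∀ {n} → Vec Bool n → Bool
isZero []       = true
isZero (x ∷ xs) = not x ∧ isZero xs

isZero-0v : ∀ {n} → isZero (0v {n}) ≡ true
isZero-0v {zero}  = refl
isZero-0v {suc n} = isZero-0v {n}

isZero⇒≡0v : ∀ {n} {v : Vec Bool n} → isZero v ≡ true → v ≡ 0v
isZero⇒≡0v {v = []}         _  = refl
isZero⇒≡0v {v = false ∷ xs} eq = cong (false ∷_) (isZero⇒≡0v eq)

length-filter-map : ∀ {m n} (c : Vec Bool m → Bool) b (g : Vec Bool n → Vec Bool m) xs →
                    length (filter (λ v → c v ≟B b) (map g xs)) ≡
                    length (filter (λ v → c (g v) ≟B b) xs)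
length-filter-map c b g []       = refl
length-filter-map c b g (x ∷ xs) with c (g x) ≟B b
... | yes _ = cong suc (length-filter-map c b g xs)
... | no _  = length-filter-map c b g xs

classSize-suc : ∀ n (c : Vec Bool (suc n) → Bool) b →
                classSize (suc n) c b ≡
                classSize n (λ v → c (false ∷ v)) b + classSize n (λ v → c (true ∷ v)) b
classSize-suc n c b = begin
  length (filter P? (map (false ∷_) (allVecs n) ++ map (true ∷_) (allVecs n)))
    ≡⟨ cong length (filter-++ P? (map (false ∷_) (allVecs n)) (map (true ∷_) (allVecs n))) ⟩
  length (filter P? (map (false ∷_) (allVecs n)) ++ filter P? (map (true ∷_) (allVecs n)))
    ≡⟨ length-++ (filter P? (map (false ∷_) (allVecs n))) ⟩
  length (filter P? (map (false ∷_) (allVecs n))) + length (filter P? (map (true ∷_) (allVecs n)))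
    ≡⟨ cong₂ _+_ (length-filter-map c b (false ∷_) (allVecs n))
                 (length-filter-map c b (true ∷_) (allVecs n)) ⟩
  classSize n (λ v → c (false ∷ v)) b + classSize n (λ v → c (true ∷ v)) b
    ∎
  where
  open ≡-Reasoning
  P? : Decidable (λ v → c v ≡ b)
  P? v = c v ≟B b

classSize-isZero : ∀ n → classSize n isZero true ≡ 1
classSize-isZero zero    = refl
classSize-isZero (suc n) = trans (classSize-suc n isZero true) (cong₂ _+_ (classSize-isZero n) no-true)
  where
  no-true : classSize n (λ _ → false) true ≡ 0
  no-true = cong length (filter-none (λ _ → false ≟B true) {allVecs n} (All.tabulate λ _ ()))

-- Local structure of LTQ_n

twist-involutive : ∀ {k} (xs : Vec Bool (suc (suc k))) → twist (twist xs) ≡ xs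
twist-involutive (c ∷ d ∷ r) = cong (_∷ d ∷ r) (xor-cancelʳ c (last (d ∷ r)))

OneDiff-sym : ∀ {n} {x y : Vec Bool n} → OneDiff x y → OneDiff y x
OneDiff-sym (here x≢y) = here (λ y≡x → x≢y (sym y≡x))
OneDiff-sym (there p)  = there (OneDiff-sym p)

LTQ-sym : ∀ {n} {x y : Vec Bool n} → LTQ x y → LTQ y x
LTQ-sym {x = []}                 {[]}                 ()
LTQ-sym {x = x ∷ []}             {y ∷ []}             ()
LTQ-sym {x = x ∷ x' ∷ []}        {y ∷ y' ∷ []}        p = OneDiff-sym p
LTQ-sym {x = false ∷ a ∷ b ∷ xs} {false ∷ c ∷ d ∷ ys} p = LTQ-sym {x = a ∷ b ∷ xs} p
LTQ-sym {x = true  ∷ a ∷ b ∷ xs} {true  ∷ c ∷ d ∷ ys} p = LTQ-sym {x = a ∷ b ∷ xs} p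
LTQ-sym {x = false ∷ a ∷ b ∷ xs} {true  ∷ c ∷ d ∷ ys} p = p
LTQ-sym {x = true  ∷ a ∷ b ∷ xs} {false ∷ c ∷ d ∷ ys} p = p

flip-head : ∀ {n} → Vec Bool (suc n) → Vec Bool (suc n)
flip-head (a ∷ xs) = not a ∷ xs

flip-head-LTQ : ∀ {k} (u v : Vec Bool (3 + k)) → LTQ u v → LTQ (flip-head u) (flip-head v)
flip-head-LTQ (false ∷ a ∷ b ∷ us) (false ∷ c ∷ d ∷ vs) p = p
flip-head-LTQ (true  ∷ a ∷ b ∷ us) (true  ∷ c ∷ d ∷ vs) p = p
flip-head-LTQ (false ∷ us@(_ ∷ _ ∷ _)) (true  ∷ vs@(_ ∷ _ ∷ _)) p =
  trans (sym (twist-involutive us)) (cong twist (sym p))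
flip-head-LTQ (true  ∷ us@(_ ∷ _ ∷ _)) (false ∷ vs@(_ ∷ _ ∷ _)) p =
  trans (sym (twist-involutive vs)) (cong twist (sym p))

flip-head-automorphism : ∀ {k} → Automorphism (Vec Bool (3 + k)) LTQ
flip-head-automorphism =
  involution-automorphism flip-head (λ { (a ∷ xs) → cong (_∷ xs) (not-involutive a) }) flip-head-LTQ

flip-head-nontrivial : ∀ {k} → ¬ IsIdentity (flip-head-automorphism {k})
flip-head-nontrivial id with id 0v
... | ()

-- `move s i` is the step along dimension i from a vertex whose last
-- coordinate is s: for s = true and i ≤ n - 3 it also flips coordinate i + 1.
move : ∀ {n} → Bool → ℕ → Vec Bool n
move {zero}              s i       = []
move {suc zero}          s i       = unit i
move {suc (suc zero)}    s i       = unit i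
move {suc (suc (suc n))} s zero    = true ∷ s ∷ 0v
move {suc (suc (suc n))} s (suc i) = false ∷ move s i

move-false : ∀ {n} i → move {n} false i ≡ unit i
move-false {zero}              i       = refl
move-false {suc zero}          i       = refl
move-false {suc (suc zero)}    i       = refl
move-false {suc (suc (suc n))} zero    = refl
move-false {suc (suc (suc n))} (suc i) = cong (false ∷_) (move-false i)

move-true-< : ∀ m {i} → i < m → move {suc (suc m)} true i ≡ unit i ⊕ unit (suc i)
move-true-< (suc m) {zero}  _         = cong (λ v → true ∷ true ∷ v) (sym (⊕-identityʳ 0v))
move-true-< (suc m) {suc i} (s≤s i<m) = cong (false ∷_) (move-true-< m i<m)

move-true-≥ : ∀ m {i} → m ≤ i → move {suc (suc m)} true i ≡ unit i
move-true-≥ zero    _         = refl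
move-true-≥ (suc m) (s≤s m≤i) = cong (false ∷_) (move-true-≥ m m≤i)

private
  ≢⇒≡xor-true : ∀ {a b} → a ≢ b → b ≡ a xor true
  ≢⇒≡xor-true {a} a≢b =
    trans (¬-not (λ b≡a → a≢b (sym b≡a))) (trans (sym (true-xor a)) (xor-comm true a))

  ≡xor-true⇒≢ : ∀ a → a ≢ a xor true
  ≡xor-true⇒≢ false ()
  ≡xor-true⇒≢ true  ()

LTQ⇒move : ∀ {k} {x y : Vec Bool (suc (suc k))} → LTQ x y →
           Σ ℕ λ i → i < suc (suc k) × y ≡ x ⊕ move (last x) i
LTQ⇒move {x = a ∷ a' ∷ []} {b ∷ .a' ∷ []} (here a≢b) =
  0 , s≤s z≤n , cong₂ _∷_ (≢⇒≡xor-true a≢b) (cong (_∷ []) (sym (xor-identityʳ a')))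
LTQ⇒move {x = a ∷ a' ∷ []} {.a ∷ b' ∷ []} (there (here a'≢b')) =
  1 , s≤s (s≤s z≤n) , cong₂ _∷_ (sym (xor-identityʳ a)) (cong (_∷ []) (≢⇒≡xor-true a'≢b'))
LTQ⇒move {x = a ∷ a' ∷ []} {.a ∷ .a' ∷ []} (there (there ()))
LTQ⇒move {x = false ∷ xs@(_ ∷ _ ∷ _)} {false ∷ ys} p with LTQ⇒move {x = xs} p
... | i , i<n , eq = suc i , s≤s i<n , cong (false ∷_) eq
LTQ⇒move {x = true ∷ xs@(_ ∷ _ ∷ _)} {true ∷ ys} p with LTQ⇒move {x = xs} p
... | i , i<n , eq = suc i , s≤s i<n , cong (true ∷_) eq
LTQ⇒move {x = false ∷ b ∷ c ∷ xs} {true ∷ ys} refl =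
  0 , s≤s z≤n , cong (λ v → true ∷ (b xor last (c ∷ xs)) ∷ v) (sym (⊕-identityʳ (c ∷ xs)))
LTQ⇒move {x = true ∷ xs@(_ ∷ _ ∷ _)} {false ∷ c ∷ d ∷ ys} refl =
  0 , s≤s z≤n ,
  cong (false ∷_) (cong₂ _∷_ (sym (xor-cancelʳ c (last (d ∷ ys)))) (sym (⊕-identityʳ (d ∷ ys))))

move⇒LTQ : ∀ {k} (x : Vec Bool (suc (suc k))) {i} → i < suc (suc k) → LTQ x (x ⊕ move (last x) i)
move⇒LTQ {zero}  (a ∷ b ∷ []) {zero}  _ rewrite xor-identityʳ b = here (≡xor-true⇒≢ a)
move⇒LTQ {zero}  (a ∷ b ∷ []) {1}     _ rewrite xor-identityʳ a = there (here (≡xor-true⇒≢ b))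
move⇒LTQ {zero}  (a ∷ b ∷ []) {suc (suc i)} (s≤s (s≤s ()))
move⇒LTQ {suc k} (false ∷ a ∷ b ∷ xs) {zero} _ =
  cong ((a xor last (b ∷ xs)) ∷_) (⊕-identityʳ (b ∷ xs))
move⇒LTQ {suc k} (true ∷ a ∷ b ∷ xs) {zero} _ rewrite ⊕-identityʳ (b ∷ xs) =
  cong (_∷ b ∷ xs) (sym (xor-cancelʳ a (last (b ∷ xs))))
move⇒LTQ {suc k} (false ∷ a ∷ b ∷ xs) {suc i} (s≤s i<n) = move⇒LTQ (a ∷ b ∷ xs) i<n
move⇒LTQ {suc k} (true  ∷ a ∷ b ∷ xs) {suc i} (s≤s i<n) = move⇒LTQ (a ∷ b ∷ xs) i<n

LTQ? : ∀ {k} (x y : Vec Bool (suc (suc k))) → Dec (LTQ x y)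
LTQ? {k} x y = map′ (λ (i , i<n , y≡) → subst (LTQ x) (sym y≡) (move⇒LTQ x i<n)) LTQ⇒move
                    (anyUpTo? (λ i → y ≟ᵥ x ⊕ move (last x) i) (suc (suc k)))

-- Rigidity of LTQ_n for n ≥ 4

module Rigidity (m : ℕ) (2≤m : 2 ≤ m) where
  private
    n L : ℕ
    n = suc (suc m)
    L = suc m

    V : Set
    V = Vec Bool n

    e : ℕ → V
    e = unit

    L<n : L < n
    L<n = ≤-refl

    m<L : m < L
    m<L = ≤-refl

    m<n : m < n
    m<n = <-trans m<L L<n

    <m⇒<n : ∀ {k} → k < m → k < n
    <m⇒<n k<m = <-trans k<m m<n

    <m⇒suc<n : ∀ {k} → k < m → suc k < n
    <m⇒suc<n k<m = s≤s (m≤n⇒m≤1+n k<m)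

    <m⇒≢L : ∀ {k} → k < m → k ≢ L
    <m⇒≢L k<m = <⇒≢ (<-trans k<m m<L)

    <m⇒suc≢L : ∀ {k} → k < m → suc k ≢ L
    <m⇒suc≢L k<m 1+k≡L = <⇒≢ k<m (suc-injective 1+k≡L)

    ≢L⇒≤m : ∀ {i} → i < n → i ≢ L → i ≤ m
    ≢L⇒≤m (s≤s i≤L) i≢L with ≤∧≢⇒< i≤L i≢L
    ... | s≤s i≤m = i≤m

    last-e : ∀ {i} → i ≢ L → last (e i) ≡ false
    last-e {i} i≢L = trans (last≡bit (e i)) (bit-unit-other {n} i≢L)

    last-eL : last (e L) ≡ true
    last-eL = trans (last≡bit (e L)) (bit-unit-same L<n)

    last-0v : last (0v {n}) ≡ false
    last-0v = trans (last≡bit (0v {n})) (bit-0v {n} L)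

    last-e⊕e : ∀ {i j} → i ≢ L → j ≢ L → last (e i ⊕ e j) ≡ false
    last-e⊕e {i} {j} i≢L j≢L = trans (last-⊕ (e i) (e j)) (cong₂ _xor_ (last-e i≢L) (last-e j≢L))

  infix 4 _∼_
  -- Unlike LTQ x y, which computes, the type x ∼ y determines x and y during unification.
  data _∼_ (x y : V) : Set where
    edge : LTQ x y → x ∼ y

  private
    ∼-sym : ∀ {x y} → x ∼ y → y ∼ x
    ∼-sym {x} {y} (edge p) = edge (LTQ-sym {x = x} {y} p)

    ∼⇒⊕e : ∀ {x y} → x ∼ y → last x ≡ false → Σ ℕ λ i → i < n × y ≡ x ⊕ e i
    ∼⇒⊕e {x} (edge p) lx with LTQ⇒move p
    ... | i , i<n , y≡ =
      i , i<n , trans y≡ (cong (x ⊕_) (trans (cong (λ s → move s i) lx) (move-false i)))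

    ∼⇒⊕move : ∀ {x y} → x ∼ y → last x ≡ true → Σ ℕ λ i → i < n × y ≡ x ⊕ move true i
    ∼⇒⊕move {x} (edge p) lx with LTQ⇒move p
    ... | i , i<n , y≡ = i , i<n , trans y≡ (cong (λ s → x ⊕ move s i) lx)

    ∼⊕e : ∀ {x i} → last x ≡ false → i < n → x ∼ x ⊕ e i
    ∼⊕e {x} {i} lx i<n =
      edge (subst (λ v → LTQ x (x ⊕ v)) (trans (cong (λ s → move s i) lx) (move-false i))
                  (move⇒LTQ x i<n))

    ∼⊕move : ∀ {x i} → last x ≡ true → i < n → x ∼ x ⊕ move true i
    ∼⊕move {x} {i} lx i<n = edge (subst (λ s → LTQ x (x ⊕ move s i)) lx (move⇒LTQ x i<n))

    0∼e : ∀ {i} → i < n → 0v ∼ e i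
    0∼e {i} i<n = subst (0v ∼_) (⊕-identityˡ (e i)) (∼⊕e last-0v i<n)

    0∼⇒e : ∀ {u} → 0v ∼ u → Σ ℕ λ i → i < n × u ≡ e i
    0∼⇒e p with ∼⇒⊕e p last-0v
    ... | i , i<n , u≡ = i , i<n , trans u≡ (⊕-identityˡ (e i))

    e∼e⊕e : ∀ {i j} → i ≢ L → j < n → e i ∼ e i ⊕ e j
    e∼e⊕e i≢L j<n = ∼⊕e (last-e i≢L) j<n

    eL⊕move≡ek⊕ej⇒≡L : ∀ {k i j} → k < m → i < n → j < n →
                       e L ⊕ move true i ≡ e k ⊕ e j → i ≡ L
    eL⊕move≡ek⊕ej⇒≡L {k} {i} {j} k<m i<n j<n eq with i <? m
    ... | yes i<m with cong parity (trans (cong (e L ⊕_) (sym (move-true-< m i<m))) eq)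
    ...   | odd≡even rewrite parity-⊕ (e L) (e i ⊕ e (suc i)) | parity-unit L<n
                          | parity-unit⊕unit {n} i<n (<m⇒suc<n i<m) | parity-unit⊕unit {n} (<m⇒<n k<m) j<n
                          with odd≡even
    ...     | ()
    eL⊕move≡ek⊕ej⇒≡L {k} {i} {j} k<m i<n j<n eq | no i≮m
      with unit⊕unit-injective L<n i<n (<m⇒<n k<m)
             (trans (cong (e L ⊕_) (sym (move-true-≥ m (≮⇒≥ i≮m)))) eq)
    ... | inj₁ (L≡k , _)        = contradiction (sym L≡k) (<m⇒≢L k<m)
    ... | inj₂ (inj₁ (_ , i≡k)) = contradiction (sym i≡k) (<⇒≢ (<-≤-trans k<m (≮⇒≥ i≮m)))
    ... | inj₂ (inj₂ (L≡i , _)) = sym L≡i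

    -- For b ≥ m the two sides differ in parity.  Otherwise coordinate L forces a ≡ L, and
    -- cancelling e L leaves an equation between two sums of two unit vectors.
    e⊕e⊕e≡eL⊕move⇒ : ∀ {k i a b} → k < m → i < n → a < n → b < n → i ≢ L → i ≢ suc k →
                      e i ⊕ e (suc k) ⊕ e a ≡ e L ⊕ move true b → i ≡ k ⊎ i ≡ suc (suc k)
    e⊕e⊕e≡eL⊕move⇒ {k} {i} {a} {b} k<m i<n a<n b<n i≢L i≢1+k eq with b <? m
    ... | no b≮m with cong parity (trans eq (cong (e L ⊕_) (move-true-≥ m (≮⇒≥ b≮m))))
    ...   | odd≡even rewrite parity-⊕ (e i ⊕ e (suc k)) (e a) | parity-unit⊕unit {n} i<n (<m⇒suc<n k<m)
                           | parity-unit a<n | parity-unit⊕unit {n} L<n b<n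
                           with odd≡even
    ...     | ()
    e⊕e⊕e≡eL⊕move⇒ {k} {i} {a} {b} k<m i<n a<n b<n i≢L i≢1+k eq | yes b<m
      with unit⊕unit-injective i<n (<m⇒suc<n k<m) (<m⇒<n b<m) (⊕-cancelˡ-≡ (e L) pair)
      where
      open ≡-Reasoning
      eq′ : e i ⊕ e (suc k) ⊕ e a ≡ e L ⊕ (e b ⊕ e (suc b))
      eq′ = trans eq (cong (e L ⊕_) (move-true-< m b<m))
      a≡L : a ≡ L
      a≡L = bit-unit-true⇒≡ {n} (begin
        bit (e a) L                              ≡⟨ cong (_xor bit (e a) L)
                                                      (bit-unit⊕unit-other {n} i≢L (<m⇒suc≢L k<m)) ⟨
        bit (e i ⊕ e (suc k)) L xor bit (e a) L  ≡⟨ bit-⊕ (e i ⊕ e (suc k)) (e a) L ⟨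
        bit (e i ⊕ e (suc k) ⊕ e a) L            ≡⟨ cong (λ x → bit x L) eq′ ⟩
        bit (e L ⊕ (e b ⊕ e (suc b))) L          ≡⟨ bit-⊕ (e L) (e b ⊕ e (suc b)) L ⟩
        bit (e L) L xor bit (e b ⊕ e (suc b)) L  ≡⟨ cong₂ _xor_ (bit-unit-same L<n)
                                                      (bit-unit⊕unit-other {n} (<m⇒≢L b<m) (<m⇒suc≢L b<m)) ⟩
        true                                     ∎)
      pair : e L ⊕ (e i ⊕ e (suc k)) ≡ e L ⊕ (e b ⊕ e (suc b))
      pair = begin
        e L ⊕ (e i ⊕ e (suc k))   ≡⟨ ⊕-comm (e L) (e i ⊕ e (suc k)) ⟩
        e i ⊕ e (suc k) ⊕ e L     ≡⟨ cong (λ x → e i ⊕ e (suc k) ⊕ e x) a≡L ⟨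
        e i ⊕ e (suc k) ⊕ e a     ≡⟨ eq′ ⟩
        e L ⊕ (e b ⊕ e (suc b))   ∎
    ... | inj₁ (i≡b , 1+k≡1+b)        = inj₁ (trans i≡b (sym (suc-injective 1+k≡1+b)))
    ... | inj₂ (inj₁ (i≡1+b , 1+k≡b)) = inj₂ (trans i≡1+b (cong suc (sym 1+k≡b)))
    ... | inj₂ (inj₂ (i≡1+k , _))     = ⊥-elim (i≢1+k i≡1+k)

    OnlyCommon0 : V → V → Set
    OnlyCommon0 u a = ∀ {z} → z ∼ u → z ∼ a → z ≡ 0v

    OnlyCommon0-eL-ek : ∀ {k} → k < m → OnlyCommon0 (e L) (e k)
    OnlyCommon0-eL-ek {k} k<m {z} z~eL z~ek
      with ∼⇒⊕move (∼-sym z~eL) last-eL | ∼⇒⊕e (∼-sym z~ek) (last-e (<m⇒≢L k<m))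
    ... | i , i<n , z≡₁ | j , j<n , z≡₂ with eL⊕move≡ek⊕ej⇒≡L k<m i<n j<n (trans (sym z≡₁) z≡₂)
    ...   | refl = begin
      z                     ≡⟨ z≡₁ ⟩
      e L ⊕ move true L     ≡⟨ cong (e L ⊕_) (move-true-≥ m (m≤n⇒m≤1+n ≤-refl)) ⟩
      e L ⊕ e L             ≡⟨ ⊕-self (e L) ⟩
      0v                    ∎
      where open ≡-Reasoning

    ¬OnlyCommon0-ei-ej : ∀ {i j} → i < n → j < n → i ≢ L → j ≢ L → ¬ OnlyCommon0 (e i) (e j)
    ¬OnlyCommon0-ei-ej {i} {j} i<n j<n i≢L j≢L only with i ≟ j
    ... | yes refl = i≢L (unit⊕unit≡0⇒≡ i<n (only ei⊕eL~ei ei⊕eL~ei))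
      where
      ei⊕eL~ei : e i ⊕ e L ∼ e i
      ei⊕eL~ei = ∼-sym (e∼e⊕e i≢L L<n)
    ... | no i≢j = i≢j (unit⊕unit≡0⇒≡ i<n (only (∼-sym (e∼e⊕e i≢L j<n)) ei⊕ej~ej))
      where
      ei⊕ej~ej : e i ⊕ e j ∼ e j
      ei⊕ej~ej = subst (_∼ e j) (⊕-comm (e j) (e i)) (∼-sym (e∼e⊕e j≢L i<n))

  module _ (φ : Automorphism V _∼_) (φ0 : app φ 0v ≡ 0v) where
    private
      f : V → V
      f = app φ

      0∼-app : ∀ {u} → 0v ∼ u → 0v ∼ f u
      0∼-app {u} p = subst (_∼ f u) φ0 (app-adj φ p)

      OnlyCommon0-app : ∀ {u a} → OnlyCommon0 u a → OnlyCommon0 (f u) (f a)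
      OnlyCommon0-app only {z} z~fu z~fa = begin
        z             ≡⟨ app-from φ z ⟨
        f (from z)    ≡⟨ cong f (only (pull z~fu) (pull z~fa)) ⟩
        f 0v          ≡⟨ φ0 ⟩
        0v            ∎
        where
        open ≡-Reasoning
        from : V → V
        from = Inverse.from (Automorphism.perm φ)
        pull : ∀ {w} → z ∼ f w → from z ∼ w
        pull {w} p = app-adj⁻¹ φ (subst (_∼ f w) (sym (app-from φ z)) p)

      fixes-eL : f (e L) ≡ e L
      fixes-eL = fixed-if-unique φ P preserved P-eL unique
        where
        P : V → Set
        P u = 0v ∼ u × Σ V λ a → Σ V λ b →
              0v ∼ a × 0v ∼ b × a ≢ b × OnlyCommon0 u a × OnlyCommon0 u b
        preserved : ∀ {z} → P z → P (f z)
        preserved (p , a , b , pa , pb , a≢b , only-a , only-b) =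
          0∼-app p , f a , f b , 0∼-app pa , 0∼-app pb , (λ eq → a≢b (app-injective φ eq)) ,
          OnlyCommon0-app only-a , OnlyCommon0-app only-b
        0<m : 0 < m
        0<m = <-trans (s≤s z≤n) 2≤m
        P-eL : P (e L)
        P-eL = 0∼e L<n , e 0 , e 1 , 0∼e (<m⇒<n 0<m) , 0∼e (<m⇒<n 2≤m) ,
               (λ eq → 0≢1 (unit-injective (<m⇒<n 0<m) eq)) , OnlyCommon0-eL-ek 0<m , OnlyCommon0-eL-ek 2≤m
          where
          0≢1 : 0 ≢ 1
          0≢1 ()
        unique : ∀ {z} → P z → z ≡ e L ⊎ f z ≡ z
        unique (p , a , b , pa , pb , a≢b , only-a , only-b) with 0∼⇒e p | 0∼⇒e pa | 0∼⇒e pb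
        ... | i , i<n , refl | ia , ia<n , refl | ib , ib<n , refl with i ≟ L | ia ≟ L | ib ≟ L
        ...   | yes refl | _       | _        = inj₁ refl
        ...   | no i≢L   | no ia≢L | _        = ⊥-elim (¬OnlyCommon0-ei-ej i<n ia<n i≢L ia≢L only-a)
        ...   | no i≢L   | yes _   | no ib≢L  = ⊥-elim (¬OnlyCommon0-ei-ej i<n ib<n i≢L ib≢L only-b)
        ...   | no _     | yes refl | yes refl = ⊥-elim (a≢b refl)

      fixes-em : f (e m) ≡ e m
      fixes-em = fixed-if-unique φ P preserved P-em unique
        where
        P : V → Set
        P u = 0v ∼ u × u ≢ e L × Σ V λ w → w ≢ 0v × w ∼ u × w ∼ e L
        preserved : ∀ {z} → P z → P (f z)
        preserved (p , u≢eL , w , w≢0 , w~u , w~eL) =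
          0∼-app p , app-≢-fixed φ fixes-eL u≢eL , f w , app-≢-fixed φ φ0 w≢0 , app-adj φ w~u ,
          app-adj-fixed φ fixes-eL w~eL
        m≢L : m ≢ L
        m≢L = <⇒≢ m<L
        P-em : P (e m)
        P-em = 0∼e m<n , (λ eq → m≢L (unit-injective m<n eq)) , e m ⊕ e L ,
               (λ eq → m≢L (unit⊕unit≡0⇒≡ m<n eq)) , ∼-sym (e∼e⊕e m≢L L<n) ,
               subst (_∼ e L) (trans (cong (e L ⊕_) (move-true-≥ m ≤-refl)) (⊕-comm (e L) (e m)))
                     (∼-sym (∼⊕move last-eL m<n))
        unique : ∀ {z} → P z → z ≡ e m ⊎ f z ≡ z
        unique (p , u≢eL , w , w≢0 , w~u , w~eL) with 0∼⇒e p
        ... | i , i<n , refl with i ≟ L | i ≟ m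
        ...   | yes refl | _        = ⊥-elim (u≢eL refl)
        ...   | no _     | yes refl = inj₁ refl
        ...   | no i≢L   | no i≢m   =
          ⊥-elim (w≢0 (OnlyCommon0-eL-ek (≤∧≢⇒< (≢L⇒≤m i<n i≢L) i≢m) w~eL w~u))

      fixes-e-below : ∀ {k} → k < m → f (e (suc k)) ≡ e (suc k) →
                      f (e (suc (suc k))) ≡ e (suc (suc k)) → f (e k) ≡ e k
      fixes-e-below {k} k<m fix₁ fix₂ = fixed-if-unique φ P preserved P-ek unique
        where
        P : V → Set
        P u = 0v ∼ u × u ≢ e L × u ≢ e (suc k) × u ≢ e (suc (suc k)) ×
              Σ V λ c → c ≢ 0v × c ∼ u × c ∼ e (suc k) × Σ V λ w → w ∼ c × w ∼ e L
        preserved : ∀ {z} → P z → P (f z)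
        preserved (p , ≢eL , ≢e₁ , ≢e₂ , c , c≢0 , c~u , c~e₁ , w , w~c , w~eL) =
          0∼-app p ,
          app-≢-fixed φ fixes-eL ≢eL , app-≢-fixed φ fix₁ ≢e₁ , app-≢-fixed φ fix₂ ≢e₂ ,
          f c , app-≢-fixed φ φ0 c≢0 , app-adj φ c~u , app-adj-fixed φ fix₁ c~e₁ ,
          f w , app-adj φ w~c , app-adj-fixed φ fixes-eL w~eL
        k<n : k < n
        k<n = <m⇒<n k<m
        1+k<n : suc k < n
        1+k<n = <m⇒suc<n k<m
        k≢L : k ≢ L
        k≢L = <m⇒≢L k<m
        1+k≢L : suc k ≢ L
        1+k≢L = <m⇒suc≢L k<m
        k≢1+k : k ≢ suc k
        k≢1+k ()
        k≢2+k : k ≢ suc (suc k)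
        k≢2+k ()
        c : V
        c = e k ⊕ e (suc k)
        P-ek : P (e k)
        P-ek = 0∼e k<n , (λ eq → k≢L (unit-injective k<n eq)) , (λ eq → k≢1+k (unit-injective k<n eq)) ,
               (λ eq → k≢2+k (unit-injective k<n eq)) ,
               c , (λ eq → k≢1+k (unit⊕unit≡0⇒≡ k<n eq)) , ∼-sym (e∼e⊕e k≢L 1+k<n) ,
               subst (_∼ e (suc k)) (⊕-comm (e (suc k)) (e k)) (∼-sym (e∼e⊕e 1+k≢L k<n)) ,
               c ⊕ e L , ∼-sym (∼⊕e (last-e⊕e k≢L 1+k≢L) L<n) ,
               subst (_∼ e L) (trans (cong (e L ⊕_) (move-true-< m k<m)) (⊕-comm (e L) c))
                     (∼-sym (∼⊕move last-eL k<n))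
        unique : ∀ {z} → P z → z ≡ e k ⊎ f z ≡ z
        unique (p , ≢eL , ≢e₁ , ≢e₂ , c′ , c′≢0 , c′~u , c′~e₁ , w , w~c′ , w~eL) with 0∼⇒e p
        ... | i , i<n , refl = inj₁ (cong e i≡k)
          where
          i≢L : i ≢ L
          i≢L i≡L = ≢eL (cong e i≡L)
          i≢1+k : i ≢ suc k
          i≢1+k i≡1+k = ≢e₁ (cong e i≡1+k)
          c′≡ : c′ ≡ e i ⊕ e (suc k)
          c′≡ with ∼⇒⊕e (∼-sym c′~u) (last-e i≢L) | ∼⇒⊕e (∼-sym c′~e₁) (last-e 1+k≢L)
          ... | a , a<n , c′≡₁ | b , b<n , c′≡₂
            with unit⊕unit-injective i<n a<n 1+k<n (trans (sym c′≡₁) c′≡₂)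
          ...   | inj₁ (i≡1+k , _)        = ⊥-elim (i≢1+k i≡1+k)
          ...   | inj₂ (inj₁ (_ , a≡1+k)) = trans c′≡₁ (cong (λ j → e i ⊕ e j) a≡1+k)
          ...   | inj₂ (inj₂ (i≡a , _))   =
            ⊥-elim (c′≢0 (trans c′≡₁ (trans (cong (λ j → e i ⊕ e j) (sym i≡a)) (⊕-self (e i)))))
          i≡k : i ≡ k
          i≡k with ∼⇒⊕e (∼-sym w~c′) (trans (cong last c′≡) (last-e⊕e i≢L 1+k≢L))
                 | ∼⇒⊕move (∼-sym w~eL) last-eL
          ... | a , a<n , w≡₁ | b , b<n , w≡₂
            with e⊕e⊕e≡eL⊕move⇒ k<m i<n a<n b<n i≢L i≢1+k
                   (trans (sym (trans w≡₁ (cong (_⊕ e a) c′≡))) w≡₂)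
          ...   | inj₁ i≡k   = i≡k
          ...   | inj₂ i≡2+k = ⊥-elim (≢e₂ (cong e i≡2+k))

      fixes-e-pair : ∀ d {k} → d + k ≡ m → f (e k) ≡ e k × f (e (suc k)) ≡ e (suc k)
      fixes-e-pair zero    refl = fixes-em , fixes-eL
      fixes-e-pair (suc d) {k} 1+d+k≡m with fixes-e-pair d {suc k} (trans (+-suc d k) 1+d+k≡m)
      ... | fix₁ , fix₂ = fixes-e-below k<m fix₁ fix₂ , fix₁
        where
        k<m : k < m
        k<m = subst (k <_) 1+d+k≡m (s≤s (m≤n+m k d))

      fixes-e : ∀ {i} → i < n → f (e i) ≡ e i
      fixes-e {i} i<n with i ≟ L
      ... | yes refl = fixes-eL
      ... | no i≢L   = proj₁ (fixes-e-pair (m ∸ i) (m∸n+n≡m (≢L⇒≤m i<n i≢L)))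

      Star : V → Set
      Star x = f x ≡ x × (∀ {i} → i < n → f (x ⊕ e i) ≡ x ⊕ e i)

      star-0 : Star 0v
      star-0 = φ0 , λ {i} i<n →
        trans (cong f (⊕-identityˡ (e i))) (trans (fixes-e i<n) (sym (⊕-identityˡ (e i))))

      fixes-fourth-corner : ∀ {x i j} → last x ≡ false → i < n → j < n →
                            i ≢ L → j ≢ L → i ≢ j →
                            f x ≡ x → f (x ⊕ e j) ≡ x ⊕ e j → f (x ⊕ e i) ≡ x ⊕ e i →
                            f (x ⊕ e j ⊕ e i) ≡ x ⊕ e j ⊕ e i
      fixes-fourth-corner {x} {i} {j} lx i<n j<n i≢L j≢L i≢j fx fy fxi =
        fixed-if-unique φ P preserved P-y⊕ei unique
        where
        y xi : V
        y = x ⊕ e j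
        xi = x ⊕ e i
        ly : last y ≡ false
        ly = trans (last-⊕ x (e j)) (cong₂ _xor_ lx (last-e j≢L))
        lxi : last xi ≡ false
        lxi = trans (last-⊕ x (e i)) (cong₂ _xor_ lx (last-e i≢L))
        P : V → Set
        P z = z ∼ y × z ∼ xi × z ≢ x
        preserved : ∀ {z} → P z → P (f z)
        preserved (z~y , z~xi , z≢x) =
          app-adj-fixed φ fy z~y , app-adj-fixed φ fxi z~xi , app-≢-fixed φ fx z≢x
        P-y⊕ei : P (y ⊕ e i)
        P-y⊕ei = ∼-sym (∼⊕e ly i<n) ,
                 subst (_∼ xi) (⊕-swapʳ x (e i) (e j)) (∼-sym (∼⊕e lxi j<n)) ,
                 λ eq → i≢j (sym (unit⊕unit≡0⇒≡ j<n (⊕-cancelˡ-≡ x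
                           (trans (sym (⊕-assoc x (e j) (e i))) (trans eq (sym (⊕-identityʳ x)))))))
        unique : ∀ {z} → P z → z ≡ y ⊕ e i ⊎ f z ≡ z
        unique {z} (z~y , z~xi , z≢x) with ∼⇒⊕e (∼-sym z~y) ly | ∼⇒⊕e (∼-sym z~xi) lxi
        ... | a , a<n , z≡₁ | b , b<n , z≡₂ with unit⊕unit-injective j<n a<n i<n (⊕-cancelˡ-≡ x (begin
              x ⊕ (e j ⊕ e a)   ≡⟨ ⊕-assoc x (e j) (e a) ⟨
              y ⊕ e a           ≡⟨ z≡₁ ⟨
              z                 ≡⟨ z≡₂ ⟩
              xi ⊕ e b          ≡⟨ ⊕-assoc x (e i) (e b) ⟩
              x ⊕ (e i ⊕ e b)   ∎))
          where open ≡-Reasoning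
        ...   | inj₁ (j≡i , _)        = ⊥-elim (i≢j (sym j≡i))
        ...   | inj₂ (inj₁ (_ , a≡i)) = inj₁ (trans z≡₁ (cong (λ k → y ⊕ e k) a≡i))
        ...   | inj₂ (inj₂ (j≡a , _)) =
          ⊥-elim (z≢x (trans z≡₁ (trans (cong (λ k → y ⊕ e k) (sym j≡a)) (x⊕y⊕y≡x x (e j)))))

      star-step : ∀ {x j} → last x ≡ false → Star x → j < n → j ≢ L → Star (x ⊕ e j)
      star-step {x} {j} lx (fx , fx⊕e) j<n j≢L = fy , fy⊕e
        where
        y : V
        y = x ⊕ e j
        fy : f y ≡ y
        fy = fx⊕e j<n
        ly : last y ≡ false
        ly = trans (last-⊕ x (e j)) (cong₂ _xor_ lx (last-e j≢L))
        fy⊕e-≢L : ∀ {i} → i < n → i ≢ L → f (y ⊕ e i) ≡ y ⊕ e i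
        fy⊕e-≢L {i} i<n i≢L with i ≟ j
        ... | yes refl = subst (λ v → f v ≡ v) (sym (x⊕y⊕y≡x x (e i))) fx
        ... | no i≢j   = fixes-fourth-corner lx i<n j<n i≢L j≢L i≢j fx fy (fx⊕e i<n)
        fy⊕e : ∀ {i} → i < n → f (y ⊕ e i) ≡ y ⊕ e i
        fy⊕e {i} i<n with i ≟ L
        ... | no i≢L   = fy⊕e-≢L i<n i≢L
        ... | yes refl =
          fixed-if-unique φ (y ∼_) (λ y~z → subst (_∼ _) fy (app-adj φ y~z)) (∼⊕e ly L<n) unique
          where
          unique : ∀ {z} → y ∼ z → z ≡ y ⊕ e L ⊎ f z ≡ z
          unique y~z with ∼⇒⊕e y~z ly
          ... | a , a<n , z≡ with a ≟ L
          ...   | yes refl = inj₁ z≡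
          ...   | no a≢L   = inj₂ (trans (cong f z≡) (trans (fy⊕e-≢L a<n a≢L) (sym z≡)))

      star-below : ∀ d {x} → last x ≡ false → (∀ {p} → d ≤ p → bit x p ≡ false) → Star x
      star-below zero    {x} _  high = subst Star (sym x≡0) star-0
        where
        x≡0 : x ≡ 0v
        x≡0 = bit-ext λ p → trans (high z≤n) (sym (bit-0v {n} p))
      star-below (suc d) {x} lx high with bit x d in bit-d
      ... | false = star-below d lx high′
        where
        high′ : ∀ {p} → d ≤ p → bit x p ≡ false
        high′ {p} d≤p with d ≟ p
        ... | yes refl = bit-d
        ... | no d≢p   = high (≤∧≢⇒< d≤p d≢p)
      ... | true = subst Star (x⊕y⊕y≡x x (e d)) (star-step lx′ (star-below d lx′ high′) d<n d≢L)
        where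
        d<n : d < n
        d<n with d <? n
        ... | yes d<n = d<n
        ... | no d≮n with trans (sym bit-d) (bit-≥ x (≮⇒≥ d≮n))
        ...   | ()
        d≢L : d ≢ L
        d≢L refl with trans (sym bit-d) (trans (sym (last≡bit x)) lx)
        ... | ()
        lx′ : last (x ⊕ e d) ≡ false
        lx′ = trans (last-⊕ x (e d)) (cong₂ _xor_ lx (last-e d≢L))
        high′ : ∀ {p} → d ≤ p → bit (x ⊕ e d) p ≡ false
        high′ {p} d≤p with d ≟ p
        ... | yes refl = trans (bit-⊕ x (e d) d) (cong₂ _xor_ bit-d (bit-unit-same d<n))
        ... | no d≢p   =
          trans (bit-⊕ x (e d) p) (cong₂ _xor_ (high (≤∧≢⇒< d≤p d≢p)) (bit-unit-other {n} d≢p))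

    fixing-0-is-identity : IsIdentity φ
    fixing-0-is-identity v with last v in lv
    ... | false = proj₁ (star-below n lv (bit-≥ v))
    ... | true  =
      subst (λ w → f w ≡ w) (x⊕y⊕y≡x v (e L)) (proj₂ (star-below n lv′ (bit-≥ (v ⊕ e L))) L<n)
      where
      lv′ : last (v ⊕ e L) ≡ false
      lv′ = trans (last-⊕ v (e L)) (cong₂ _xor_ lv last-eL)

  rigid : (φ : Automorphism V LTQ) → app φ 0v ≡ 0v → IsIdentity φ
  rigid φ = fixing-0-is-identity record
    { perm     = Automorphism.perm φ
    ; preserve = λ u v → mk⇔ (λ { (edge p) → edge (app-adj φ {u} {v} p) })
                             (λ { (edge p) → edge (app-adj⁻¹ φ {u} {v} p) })
    }

LTQ-≥4 : ∀ k → DetEq (Vec Bool (4 + k)) LTQ 1 × DistEq (Vec Bool (4 + k)) LTQ 2 × RhoEq (4 + k) 1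
LTQ-≥4 k = ((0v ∷ [] , (λ φ fixed → fixing-0-is-identity φ (fixed 0v (here refl))) , refl) ,
            determining-nonempty flip-head-automorphism flip-head-nontrivial)
         , distEq-2 flip-head-automorphism flip-head-nontrivial isZero isZero-distinguishing
         , ((isZero , true , isZero-distinguishing , classSize-isZero (4 + k)) ,
            colour-classes-nonempty flip-head-automorphism flip-head-nontrivial)
  where
  fixing-0-is-identity : (φ : Automorphism (Vec Bool (4 + k)) LTQ) → app φ 0v ≡ 0v → IsIdentity φ
  fixing-0-is-identity = Rigidity.rigid (2 + k) (s≤s (s≤s z≤n))
  isZero-distinguishing : IsDistinguishing (Vec Bool (4 + k)) LTQ isZero
  isZero-distinguishing φ pres = fixing-0-is-identity φ (isZero⇒≡0v (trans (pres 0v) (isZero-0v {4 + k})))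

-- LTQ_3, by exhaustive computation

pattern v000 = false ∷ false ∷ false ∷ []
pattern v001 = false ∷ false ∷ true  ∷ []
pattern v010 = false ∷ true  ∷ false ∷ []
pattern v011 = false ∷ true  ∷ true  ∷ []
pattern v100 = true  ∷ false ∷ false ∷ []
pattern v101 = true  ∷ false ∷ true  ∷ []
pattern v110 = true  ∷ true  ∷ false ∷ []
pattern v111 = true  ∷ true  ∷ true  ∷ []

fromTable : {A : Set} → Vec A 8 → Vec Bool 3 → A
fromTable (a ∷ _ ∷ _ ∷ _ ∷ _ ∷ _ ∷ _ ∷ _ ∷ []) v000 = a
fromTable (_ ∷ a ∷ _ ∷ _ ∷ _ ∷ _ ∷ _ ∷ _ ∷ []) v001 = a
fromTable (_ ∷ _ ∷ a ∷ _ ∷ _ ∷ _ ∷ _ ∷ _ ∷ []) v010 = a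
fromTable (_ ∷ _ ∷ _ ∷ a ∷ _ ∷ _ ∷ _ ∷ _ ∷ []) v011 = a
fromTable (_ ∷ _ ∷ _ ∷ _ ∷ a ∷ _ ∷ _ ∷ _ ∷ []) v100 = a
fromTable (_ ∷ _ ∷ _ ∷ _ ∷ _ ∷ a ∷ _ ∷ _ ∷ []) v101 = a
fromTable (_ ∷ _ ∷ _ ∷ _ ∷ _ ∷ _ ∷ a ∷ _ ∷ []) v110 = a
fromTable (_ ∷ _ ∷ _ ∷ _ ∷ _ ∷ _ ∷ _ ∷ a ∷ []) v111 = a

tableOf : {A : Set} → (Vec Bool 3 → A) → Vec A 8
tableOf c = c v000 ∷ c v001 ∷ c v010 ∷ c v011 ∷ c v100 ∷ c v101 ∷ c v110 ∷ c v111 ∷ []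

fromTable-tableOf : {A : Set} (c : Vec Bool 3 → A) → ∀ v → fromTable (tableOf c) v ≡ c v
fromTable-tableOf c v000 = refl
fromTable-tableOf c v001 = refl
fromTable-tableOf c v010 = refl
fromTable-tableOf c v011 = refl
fromTable-tableOf c v100 = refl
fromTable-tableOf c v101 = refl
fromTable-tableOf c v110 = refl
fromTable-tableOf c v111 = refl

involutions₃ : List (Vec Bool 3 → Vec Bool 3)
involutions₃ = map fromTable
  ( (v000 ∷ v100 ∷ v010 ∷ v110 ∷ v001 ∷ v111 ∷ v011 ∷ v101 ∷ [])
  ∷ (v001 ∷ v000 ∷ v011 ∷ v010 ∷ v111 ∷ v110 ∷ v101 ∷ v100 ∷ [])
  ∷ (v010 ∷ v110 ∷ v000 ∷ v100 ∷ v011 ∷ v101 ∷ v001 ∷ v111 ∷ [])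
  ∷ (v011 ∷ v010 ∷ v001 ∷ v000 ∷ v101 ∷ v100 ∷ v111 ∷ v110 ∷ [])
  ∷ (v100 ∷ v101 ∷ v110 ∷ v111 ∷ v000 ∷ v001 ∷ v010 ∷ v011 ∷ [])
  ∷ (v101 ∷ v011 ∷ v111 ∷ v001 ∷ v100 ∷ v000 ∷ v110 ∷ v010 ∷ [])
  ∷ (v110 ∷ v111 ∷ v100 ∷ v101 ∷ v010 ∷ v011 ∷ v000 ∷ v001 ∷ [])
  ∷ (v111 ∷ v001 ∷ v101 ∷ v011 ∷ v110 ∷ v010 ∷ v100 ∷ v000 ∷ [])
  ∷ [])

NontrivialInvolution : (Vec Bool 3 → Vec Bool 3) → Set
NontrivialInvolution σ =
  (∀ x → σ (σ x) ≡ x) × (∀ u v → LTQ u v → LTQ (σ u) (σ v)) × ¬ (∀ x → σ x ≡ x)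

nontrivialInvolution? : Decidable NontrivialInvolution
nontrivialInvolution? σ = ∀-Vec? (λ x → σ (σ x) ≟ᵥ x)
                   ×-dec ∀-Vec? (λ u → ∀-Vec? λ v → LTQ? u v →-dec LTQ? (σ u) (σ v))
                   ×-dec ¬? (∀-Vec? λ x → σ x ≟ᵥ x)

involutions₃-nontrivial : All NontrivialInvolution involutions₃
involutions₃-nontrivial = from-yes (All.all? nontrivialInvolution? involutions₃)

some-involution : ∀ {Q : (Vec Bool 3 → Vec Bool 3) → Set} → Any Q involutions₃ →
                  Σ (Automorphism (Vec Bool 3) LTQ) λ φ → ¬ IsIdentity φ × Q (app φ)
some-involution any =
  let (σσ , adj , σ≢id) , q = All.lookupAny involutions₃-nontrivial any
  in  involution-automorphism _ σσ adj , σ≢id , q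

every-vertex-fixed-by-involution : ∀ v → Any (λ σ → σ v ≡ v) involutions₃
every-vertex-fixed-by-involution = from-yes (∀-Vec? λ v → Any.any? (λ σ → σ v ≟ᵥ v) involutions₃)

SmallClassSymmetric : Vec Bool 8 → Bool → Set
SmallClassSymmetric t b =
  3 ≤ classSize 3 (fromTable t) b ⊎
  Any (λ σ → ∀ v → fromTable t (σ v) ≡ fromTable t v) involutions₃

smallClassSymmetric? : ∀ t b → Dec (SmallClassSymmetric t b)
smallClassSymmetric? t b =
  (3 ≤? classSize 3 (fromTable t) b)
  ⊎-dec Any.any? (λ σ → ∀-Vec? λ v → fromTable t (σ v) ≟B fromTable t v) involutions₃

small-classes-symmetric : ∀ t → SmallClassSymmetric t true × SmallClassSymmetric t false
small-classes-symmetric =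
  from-yes (∀-Vec? λ t → smallClassSymmetric? t true ×-dec smallClassSymmetric? t false)

-- The colour class {000, 001, 010} is a path centred at 000.
threePath : Vec Bool 3 → Bool
threePath = fromTable (true ∷ true ∷ true ∷ false ∷ false ∷ false ∷ false ∷ false ∷ [])

CommonNeighbourUpTo : List (Vec Bool 3) → Vec Bool 3 → List (Vec Bool 3) → Set
CommonNeighbourUpTo As t Fs = All (LTQ t) As × (∀ z → All (LTQ z) As → z ≡ t ⊎ z ∈ Fs)

commonNeighbourUpTo? : ∀ As t Fs → Dec (CommonNeighbourUpTo As t Fs)
commonNeighbourUpTo? As t Fs = All.all? (LTQ? t) As
                         ×-dec ∀-Vec? (λ z → All.all? (LTQ? z) As →-dec (z ≟ᵥ t ⊎-dec z ∈? Fs))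

module _ (φ : Automorphism (Vec Bool 3) LTQ) where
  private
    f : Vec Bool 3 → Vec Bool 3
    f = app φ

    Fixed : List (Vec Bool 3) → Set
    Fixed = All (λ a → f a ≡ a)

    fixed-if-unique-upto : (P : Vec Bool 3 → Set) → (∀ {z} → P z → P (f z)) → ∀ {t} → P t →
                           ∀ {Fs} → Fixed Fs → (∀ {z} → P z → z ≡ t ⊎ z ∈ Fs) → f t ≡ t
    fixed-if-unique-upto P preserved Pt fixed unique =
      fixed-if-unique φ P preserved Pt λ Pz → Sum.map₂ (All.lookup fixed) (unique Pz)

    fixed-common-neighbour : ∀ As t Fs → Fixed As → Fixed Fs →
                             {_ : True (commonNeighbourUpTo? As t Fs)} → f t ≡ t
    fixed-common-neighbour As t Fs fixedAs fixedFs {check} =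
      fixed-if-unique-upto (λ z → All (LTQ z) As) preserved t-adj fixedFs (λ {z} → unique z)
      where
      t-adj : All (LTQ t) As
      t-adj = proj₁ (toWitness check)
      unique : ∀ z → All (LTQ z) As → z ≡ t ⊎ z ∈ Fs
      unique = proj₂ (toWitness check)
      preserved : ∀ {z} → All (LTQ z) As → All (LTQ (f z)) As
      preserved {z} z-adj = All.tabulate λ {a} a∈As →
        subst (LTQ (f z)) (All.lookup fixedAs a∈As) (app-adj φ {z} {a} (All.lookup z-adj a∈As))

  fixes-000-100⇒identity : f v000 ≡ v000 → f v100 ≡ v100 → IsIdentity φ
  fixes-000-100⇒identity f000 f100 = λ where
      v000 → f000 ; v001 → f001 ; v010 → f010 ; v011 → f011
      v100 → f100 ; v101 → f101 ; v110 → f110 ; v111 → f111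
    where
    P : Vec Bool 3 → Set
    P z = LTQ z v000 × Σ (Vec Bool 3) λ w → w ≢ v000 × LTQ w z × LTQ w v100
    f010 : f v010 ≡ v010
    f010 = fixed-if-unique-upto P preserved P-010 (f100 ∷ [])
             λ (z~000 , w , w≢000 , w~z , w~100) → unique _ w z~000 w≢000 w~z w~100
      where
      P-010 : P v010
      P-010 = from-yes (LTQ? v010 v000) , v110 , (λ ()) , from-yes (LTQ? v110 v010) , from-yes (LTQ? v110 v100)
      preserved : ∀ {z} → P z → P (f z)
      preserved {z} (z~000 , w , w≢000 , w~z , w~100) =
        subst (LTQ (f z)) f000 (app-adj φ {z} {v000} z~000) , f w , app-≢-fixed φ f000 w≢000 ,
        app-adj φ {w} {z} w~z , subst (LTQ (f w)) f100 (app-adj φ {w} {v100} w~100)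
      unique : ∀ z w → LTQ z v000 → w ≢ v000 → LTQ w z → LTQ w v100 → z ≡ v010 ⊎ z ∈ v100 ∷ []
      unique = from-yes (∀-Vec? λ z → ∀-Vec? λ w →
                 LTQ? z v000 →-dec ¬? (w ≟ᵥ v000) →-dec LTQ? w z →-dec LTQ? w v100 →-dec
                 (z ≟ᵥ v010 ⊎-dec z ∈? v100 ∷ []))
    f001 : f v001 ≡ v001
    f001 = fixed-common-neighbour (v000 ∷ []) v001 (v100 ∷ v010 ∷ []) (f000 ∷ []) (f100 ∷ f010 ∷ [])
    f011 : f v011 ≡ v011
    f011 = fixed-common-neighbour (v001 ∷ v010 ∷ []) v011 (v000 ∷ []) (f001 ∷ f010 ∷ []) (f000 ∷ [])
    f111 : f v111 ≡ v111
    f111 = fixed-common-neighbour (v001 ∷ []) v111 (v000 ∷ v011 ∷ []) (f001 ∷ []) (f000 ∷ f011 ∷ [])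
    f110 : f v110 ≡ v110
    f110 = fixed-common-neighbour (v100 ∷ v010 ∷ []) v110 (v000 ∷ []) (f100 ∷ f010 ∷ []) (f000 ∷ [])
    f101 : f v101 ≡ v101
    f101 = fixed-common-neighbour (v100 ∷ []) v101 (v000 ∷ v110 ∷ []) (f100 ∷ []) (f000 ∷ f110 ∷ [])

  preserves-threePath⇒identity : (∀ v → threePath (f v) ≡ threePath v) → IsIdentity φ
  preserves-threePath⇒identity preserves = fixes-000-100⇒identity f000 f100
    where
    Centre : Vec Bool 3 → Set
    Centre z = threePath z ≡ true × Σ (Vec Bool 3) λ a → Σ (Vec Bool 3) λ b →
               a ≢ b × threePath a ≡ true × threePath b ≡ true × LTQ z a × LTQ z b
    f000 : f v000 ≡ v000
    f000 = fixed-if-unique φ Centre preserved centre-000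
             λ (cz , a , b , a≢b , ca , cb , z~a , z~b) → inj₁ (unique _ a b cz a≢b ca cb z~a z~b)
      where
      centre-000 : Centre v000
      centre-000 = refl , v001 , v010 , (λ ()) , refl , refl ,
                   from-yes (LTQ? v000 v001) , from-yes (LTQ? v000 v010)
      preserved : ∀ {z} → Centre z → Centre (f z)
      preserved {z} (cz , a , b , a≢b , ca , cb , z~a , z~b) =
        trans (preserves z) cz , f a , f b , (λ eq → a≢b (app-injective φ eq)) ,
        trans (preserves a) ca , trans (preserves b) cb , app-adj φ {z} {a} z~a , app-adj φ {z} {b} z~b
      unique : ∀ z a b → threePath z ≡ true → a ≢ b → threePath a ≡ true → threePath b ≡ true →
               LTQ z a → LTQ z b → z ≡ v000
      unique = from-yes (∀-Vec? λ z → ∀-Vec? λ a → ∀-Vec? λ b →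
                 threePath z ≟B true →-dec ¬? (a ≟ᵥ b) →-dec
                 threePath a ≟B true →-dec threePath b ≟B true →-dec
                 LTQ? z a →-dec LTQ? z b →-dec z ≟ᵥ v000)
    f100 : f v100 ≡ v100
    f100 = fixed-if-unique φ (λ z → threePath z ≡ false × LTQ z v000) preserved
             (refl , from-yes (LTQ? v100 v000)) λ (cz , z~000) → inj₁ (unique _ cz z~000)
      where
      preserved : ∀ {z} → threePath z ≡ false × LTQ z v000 → threePath (f z) ≡ false × LTQ (f z) v000
      preserved {z} (cz , z~000) = trans (preserves z) cz , subst (LTQ (f z)) f000 (app-adj φ {z} {v000} z~000)
      unique : ∀ z → threePath z ≡ false → LTQ z v000 → z ≡ v100
      unique = from-yes (∀-Vec? λ z → threePath z ≟B false →-dec LTQ? z v000 →-dec z ≟ᵥ v100)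

LTQ₃ : DetEq (Vec Bool 3) LTQ 2 × DistEq (Vec Bool 3) LTQ 2 × RhoEq 3 3
LTQ₃ = ((v000 ∷ v100 ∷ [] , determining , refl) , determining-≥2)
     , distEq-2 flip-head-automorphism flip-head-nontrivial threePath preserves-threePath⇒identity
     , ((threePath , true , preserves-threePath⇒identity , refl) , class-≥3)
  where
  determining : IsDetermining (Vec Bool 3) LTQ (v000 ∷ v100 ∷ [])
  determining φ fixed = fixes-000-100⇒identity φ (fixed v000 (here refl)) (fixed v100 (there (here refl)))
  determining-≥2 : ∀ S → IsDetermining (Vec Bool 3) LTQ S → 2 ≤ length S
  determining-≥2 []          det with determining-nonempty flip-head-automorphism flip-head-nontrivial [] det
  ... | ()
  determining-≥2 (v ∷ [])    det =
    let φ , φ≢id , φv≡v = some-involution (every-vertex-fixed-by-involution v)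
    in  ⊥-elim (φ≢id (det φ λ { _ (here refl) → φv≡v }))
  determining-≥2 (_ ∷ _ ∷ _) _   = s≤s (s≤s z≤n)
  class-≥3 : ∀ c b → IsDistinguishing (Vec Bool 3) LTQ c → 3 ≤ classSize 3 c b
  class-≥3 c b dist = Sum.[ subst (3 ≤_) (classSize-cong (fromTable-tableOf c) b) ,
                            (λ symmetric → ⊥-elim (not-symmetric symmetric)) ]′
                          (component b (small-classes-symmetric (tableOf c)))
    where
    component : ∀ b → SmallClassSymmetric (tableOf c) true × SmallClassSymmetric (tableOf c) false →
                SmallClassSymmetric (tableOf c) b
    component true  = proj₁
    component false = proj₂
    not-symmetric : ¬ Any (λ σ → ∀ v → fromTable (tableOf c) (σ v) ≡ fromTable (tableOf c) v) involutions₃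
    not-symmetric any =
      let φ , φ≢id , pres = some-involution any
      in  φ≢id (dist φ λ v → trans (sym (fromTable-tableOf c _)) (trans (pres v) (fromTable-tableOf c v)))

proposition8p1 : ((n : ℕ) → 4 ≤ n →
    DetEq (Vec Bool n) LTQ 1 × DistEq (Vec Bool n) LTQ 2 × RhoEq n 1)
    × (DetEq (Vec Bool 3) LTQ 2 × DistEq (Vec Bool 3) LTQ 2 × RhoEq 3 3)
proposition8p1 = (λ { _ (s≤s (s≤s (s≤s (s≤s {n = k} _)))) → LTQ-≥4 k }) , LTQ₃
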